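{- Let $n\geq 1$, let $U_{6n}=\langle a,b\mid a^{2n}=b^3=1,\ a^{ -1}ba=b^{ -1}\rangle$, and let $\Gamma=\Gamma(U_{6n})$ be its non-commuting graph. For every subset $\Omega$ of the vertex set of $\Gamma$ and every $k\geq 4$, the subgraph of $\Gamma$ induced on $\Omega$ is not the path $P_k$ on $k$ vertices.
   Context: The group $U_{6n}$ has order $6n$ and center $Z(U_{6n})=\langle a^2\rangle$. For a finite group $G$, the non-commuting graph $\Gamma(G)$ has vertex set $G\setminus Z(G)$, and two distinct vertices $x,y$ are adjacent iff $xy\neq yx$. $P_k$ denotes the path graph with $k$ vertices. -}

module Defs where

open import Data.Nat using (ℕ; zero; suc; _+_; _*_; _%_)
open import Data.Nat.DivMod using (_mod_)
open import Data.Fin using (Fin; toℕ)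
open import Data.Product using (_×_; _,_)
open import Relation.Binary.PropositionalEquality using (_≡_)
open import Relation.Nullary using (¬_)
open import Data.Sum using (_⊎_)

-- The group U_{6n} = ⟨ a, b | a^{2n} = b^3 = 1, a⁻¹ b a = b⁻¹ ⟩,
-- realised on its normal forms a^i b^j  (i ∈ ℤ/2n, j ∈ ℤ/3).  From b a = a b⁻¹ we get
-- b^j a^k = a^k b^(j (-1)^k), hence
--   (a^i b^j)(a^k b^l) = a^(i+k) b^(j (-1)^k + l),
-- and j (-1)^k ≡ j (1 + k mod 2) (mod 3).
record U (n : ℕ) : Set where
  constructor ⟨_,_⟩
  field
    aexp : Fin (2 * n)
    bexp : Fin 3

infixl 7 _·_
_·_ : {n : ℕ} → U n → U n → U n
_·_ {zero} ⟨ () , _ ⟩ _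
_·_ {suc m} ⟨ i , j ⟩ ⟨ k , l ⟩ =
  ⟨ (toℕ i + toℕ k) mod (2 * suc m) ,
    (toℕ j * (1 + toℕ k % 2) + toℕ l) mod 3 ⟩

Commute : {n : ℕ} → U n → U n → Set
Commute x y = x · y ≡ y · x

Central : {n : ℕ} → U n → Set
Central {n} z = (g : U n) → Commute z g

-- Adjacency in the non-commuting graph Γ(U_{6n}) (vertices: non-central
-- elements; x ~ y iff x y ≠ y x, which forces x ≠ y).
Adj : {n : ℕ} → U n → U n → Set
Adj x y = ¬ Commute x y

PathAdj : {k : ℕ} → Fin k → Fin k → Set
PathAdj i j = (suc (toℕ i) ≡ toℕ j) ⊎ (suc (toℕ j) ≡ toℕ i)

module Submission where

open import Defs
open import Data.Nat using (ℕ; _≤_)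
open import Data.Fin using (Fin)
open import Function.Definitions using (Injective)
open import Function.Bundles using (_⇔_)
open import Relation.Binary.PropositionalEquality using (_≡_)
open import Relation.Nullary using (¬_)

open import Data.Nat using (zero; suc; _+_; _*_; _%_; _<_; s≤s; z≤n)
open import Data.Nat.DivMod using (_mod_; m%n<n)
open import Data.Nat.Properties using (+-comm; *-identityʳ)
open import Data.Fin using (zero; suc; toℕ)
open import Data.Maybe using (Maybe; nothing; just)
open import Data.Sum using (inj₁; [_,_]′)
open import Data.Empty using (⊥-elim)
open import Function using (_∘_)
open import Function.Bundles using (mk⇔; module Equivalence)
open import Function.Construct.Composition using (_⇔-∘_)
open import Relation.Binary.PropositionalEquality using (_≢_; refl; sym; trans; cong; cong₂)
open import Relation.Nullary using (contradiction)

-- a^i b^j and a^k b^l commute iff j (-1)^k + l ≡ l (-1)^i + j (mod 3), since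
-- the a-exponents of both products agree.  Hence commuting is an equivalence
-- relation on the non-central elements: Γ is complete multipartite.  In such
-- a graph vertices 2 and 3 of an induced path would both be non-adjacent to
-- vertex 0, hence non-adjacent to each other.

no-induced-path : {A : Set} (Adj : A → A → Set) {k : ℕ} (v : Fin k → A) → 4 ≤ k →
  (∀ i j l → ¬ Adj (v i) (v j) → ¬ Adj (v i) (v l) → ¬ Adj (v j) (v l)) →
  ¬ (∀ i j → Adj (v i) (v j) ⇔ PathAdj i j)
no-induced-path Adj v (s≤s (s≤s (s≤s (s≤s _)))) nonadjacent-euclidean H =
  nonadjacent-euclidean v₀ v₂ v₃ (nonadjacent zero) (nonadjacent (suc zero))
    (Equivalence.from (H v₂ v₃) (inj₁ refl))
  where
  v₀ v₂ v₃ : Fin _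
  v₀ = zero
  v₂ = suc (suc zero)
  v₃ = suc (suc (suc zero))

  nonadjacent : ∀ j → ¬ Adj (v v₀) (v (suc (suc j)))
  nonadjacent j = [ (λ ()) , (λ ()) ]′ ∘ Equivalence.to (H v₀ (suc (suc j)))

-- The b-exponent of (a^p b^j)(a^k b^l) for k of parity q; it does not depend on p.
twist : ℕ → Fin 3 → Fin 3 → Fin 3
twist q j l = (toℕ j * (1 + q) + toℕ l) mod 3

parity : {n : ℕ} → U n → ℕ
parity x = toℕ (U.aexp x) % 2

-- nothing encodes the class ⟨a², b⟩ ∖ ⟨a²⟩, just j the odd powers of a times b^j.
classOf : ℕ → Fin 3 → Maybe (Fin 3)
classOf zero    _ = nothing
classOf (suc _) j = just j

commClass : {n : ℕ} → U n → Maybe (Fin 3)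
commClass x = classOf (parity x) (U.bexp x)

twist-even-comm : ∀ j l → twist 0 j l ≡ twist 0 l j
twist-even-comm j l = cong (_mod 3)
  (trans (cong₂ _+_ (*-identityʳ (toℕ j)) (sym (*-identityʳ (toℕ l))))
         (+-comm (toℕ j) (toℕ l * 1)))

twist-odd-even-≢ : ∀ j l → j ≢ zero → twist 1 j l ≢ twist 0 l j
twist-odd-even-≢ zero             _                j≢0 = contradiction refl j≢0
twist-odd-even-≢ (suc zero)       zero             _   ()
twist-odd-even-≢ (suc zero)       (suc zero)       _   ()
twist-odd-even-≢ (suc zero)       (suc (suc zero)) _   ()
twist-odd-even-≢ (suc (suc zero)) zero             _   ()
twist-odd-even-≢ (suc (suc zero)) (suc zero)       _   ()
twist-odd-even-≢ (suc (suc zero)) (suc (suc zero)) _   ()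

twist-odd-comm⇒≡ : ∀ j l → twist 1 j l ≡ twist 1 l j → j ≡ l
twist-odd-comm⇒≡ zero             zero             _ = refl
twist-odd-comm⇒≡ zero             (suc zero)       ()
twist-odd-comm⇒≡ zero             (suc (suc zero)) ()
twist-odd-comm⇒≡ (suc zero)       zero             ()
twist-odd-comm⇒≡ (suc zero)       (suc zero)       _ = refl
twist-odd-comm⇒≡ (suc zero)       (suc (suc zero)) ()
twist-odd-comm⇒≡ (suc (suc zero)) zero             ()
twist-odd-comm⇒≡ (suc (suc zero)) (suc zero)       ()
twist-odd-comm⇒≡ (suc (suc zero)) (suc (suc zero)) _ = refl

twist-comm⇔sameClass : ∀ {p q j l} → p < 2 → q < 2 →
  (p ≡ 0 → j ≢ zero) → (q ≡ 0 → l ≢ zero) →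
  twist q j l ≡ twist p l j ⇔ classOf p j ≡ classOf q l
twist-comm⇔sameClass {j = j} {l} (s≤s z≤n) (s≤s z≤n) _ _ =
  mk⇔ (λ _ → refl) (λ _ → twist-even-comm j l)
twist-comm⇔sameClass {j = j} {l} (s≤s z≤n) (s≤s (s≤s z≤n)) j≢0 _ =
  mk⇔ (⊥-elim ∘ twist-odd-even-≢ j l (j≢0 refl)) (λ ())
twist-comm⇔sameClass {j = j} {l} (s≤s (s≤s z≤n)) (s≤s z≤n) _ l≢0 =
  mk⇔ (⊥-elim ∘ twist-odd-even-≢ l j (l≢0 refl) ∘ sym) (λ ())
twist-comm⇔sameClass {j = j} {l} (s≤s (s≤s z≤n)) (s≤s (s≤s z≤n)) _ _ =
  mk⇔ (cong just ∘ twist-odd-comm⇒≡ j l) (λ { refl → refl })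

module _ {m : ℕ} where

  commute⇔twist-comm : (x y : U (suc m)) →
    Commute x y ⇔ twist (parity y) (U.bexp x) (U.bexp y) ≡ twist (parity x) (U.bexp y) (U.bexp x)
  commute⇔twist-comm ⟨ i , j ⟩ ⟨ k , l ⟩ =
    mk⇔ (cong U.bexp) (cong₂ ⟨_,_⟩ (cong (_mod (2 * suc m)) (+-comm (toℕ i) (toℕ k))))

  even-bFree-central : (x : U (suc m)) → parity x ≡ 0 → U.bexp x ≡ zero → Central x
  even-bFree-central x@(⟨ i , zero ⟩) even refl g@(⟨ k , l ⟩) =
    Equivalence.from (commute⇔twist-comm x g) (bFree-twist l)
    where
    bFree-twist : ∀ l → twist (parity g) zero l ≡ twist (parity x) l zero
    bFree-twist l rewrite even with l
    ... | zero           = refl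
    ... | suc zero       = refl
    ... | suc (suc zero) = refl

  commute⇔sameClass : {x y : U (suc m)} → ¬ Central x → ¬ Central y →
    Commute x y ⇔ commClass x ≡ commClass y
  commute⇔sameClass {x} {y} x∉Z y∉Z =
    twist-comm⇔sameClass (m%n<n (toℕ (U.aexp x)) 2) (m%n<n (toℕ (U.aexp y)) 2)
      (λ even → x∉Z ∘ even-bFree-central x even)
      (λ even → y∉Z ∘ even-bFree-central y even)
    ⇔-∘ commute⇔twist-comm x y

  commute-euclidean : {x y z : U (suc m)} → ¬ Central x → ¬ Central y → ¬ Central z →
    Commute x y → Commute x z → Commute y z
  commute-euclidean x∉Z y∉Z z∉Z xy xz =
    Equivalence.from (commute⇔sameClass y∉Z z∉Z)
      (trans (sym (Equivalence.to (commute⇔sameClass x∉Z y∉Z) xy))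
             (Equivalence.to (commute⇔sameClass x∉Z z∉Z) xz))

  nonadjacent-euclidean : {x y z : U (suc m)} → ¬ Central x → ¬ Central y → ¬ Central z →
    ¬ Adj x y → ¬ Adj x z → ¬ Adj y z
  nonadjacent-euclidean x∉Z y∉Z z∉Z ¬¬xy ¬¬xz ¬yz =
    ¬¬xy λ xy → ¬¬xz λ xz → ¬yz (commute-euclidean x∉Z y∉Z z∉Z xy xz)

theorem2p11 : (n : ℕ) → 1 ≤ n → (k : ℕ) → 4 ≤ k →
    (v : Fin k → U n) → Injective _≡_ _≡_ v →
    ((i : Fin k) → ¬ Central (v i)) →
    ¬ ((i j : Fin k) → Adj (v i) (v j) ⇔ PathAdj i j)
theorem2p11 zero () _ _ _ _ _
theorem2p11 (suc m) _ _ 4≤k v _ nonCentral =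
  no-induced-path Adj v 4≤k λ i j l →
    nonadjacent-euclidean (nonCentral i) (nonCentral j) (nonCentral l)
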